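{- Let $\phi$ be an $\mathsf{LTL}_f$ formula and let $\mathcal{C}=\mathcal{C}[0],\mathcal{C}[1],\ldots,\mathcal{C}[|\mathcal{C}|-1]$ be a conflict sequence for the transition system $T_\phi$. Then for every $i$ with $0\le i<|\mathcal{C}|$, every state in $\bigcap_{0\le j\le i}\mathcal{C}[j]$ cannot reach a final state of $T_\phi$ in up to $i$ steps; that is, for every such state $s$ and every $k$ with $0\le k\le i$, there is no path $s=t_0\to t_1\to\cdots\to t_k$ in $T_\phi$ with $t_k$ a final state.
   Context: $\mathsf{LTL}_f$ is linear temporal logic interpreted over finite nonempty traces over a finite set $P$ of atoms. $Tail$ denotes the formula that holds exactly at the last position of a trace. For a formula $\psi$, $\mathrm{xnf}(\psi)$ is its neXt normal form, an $\mathsf{LTL}_f$ formula equivalent to $\psi$ (possibly containing $Tail$) in which every temporal subformula occurs in the scope of a next operator $\mathsf{X}$; for a set $s$ of formulas, $\mathrm{xnf}(s)=\bigwedge_{\psi\in s}\mathrm{xnf}(\psi)$. For a formula $\theta$, $\theta^p$ is its propositional abstraction, obtained by treating each subformula of the form $\mathsf{X}\chi$ (and $Tail$) as a fresh Boolean variable. The transition system $T_\phi$ has as states finite sets of $\mathsf{LTL}_f$ formulas (each read as the conjunction of its elements), initial state $s_0=\{\phi\}$, and a transition $s\to s'$ whenever there is a satisfying assignment $A$ of $\mathrm{xnf}(s)^p$ with $s'=\{\chi : \text{the variable for } \mathsf{X}\chi \text{ is true in } A\}$; $s'$ is then called a one-transition next state of $s$. A state $s$ is final iff the Boolean formula $Tail\wedge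 \mathrm{xnf}(s)^p$ is satisfiable. A conflict sequence for $T_\phi$ is a finite nonempty sequence $\mathcal{C}[0],\ldots,\mathcal{C}[|\mathcal{C}|-1]$ of sets of states of $T_\phi$ such that: (1) $s_0=\{\phi\}\in\mathcal{C}[i]$ for all $0\le i<|\mathcal{C}|$; (2) no state in $\mathcal{C}[0]$ is final; (3) for every $0\le i<|\mathcal{C}|-1$ and every $s\in\mathcal{C}[i+1]$, all one-transition next states of $s$ belong to $\mathcal{C}[i]$. -}

module Defs where

open import Data.Nat using (ℕ; zero; suc; _<_; _≤_)
open import Data.Fin using (Fin)
open import Data.Bool using (Bool; true; false; not; _∧_; _∨_)
open import Data.List using (List; []; _∷_; _++_; foldr)
open import Data.List.Membership.Propositional using (_∈_)
open import Data.Product using (Σ; _×_; _,_)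
open import Data.Empty using (⊥)
open import Relation.Binary.PropositionalEquality using (_≡_)
open import Function.Bundles using (_⇔_)

-- Atoms: the finite set P is Fin n.
-- LTLf formulas in negation normal form (as in the paper):
-- tt, ff, literals, ∧, ∨, strong next X, weak next N, until U, release R.
data Formula (n : ℕ) : Set where
  tt ff : Formula n
  atom natom : Fin n → Formula n
  _∧ᶠ_ _∨ᶠ_ : Formula n → Formula n → Formula n
  X N : Formula n → Formula n
  _U_ _R_ : Formula n → Formula n → Formula n

-- Tail holds exactly at the last position: Tail = N ff, ¬Tail = X tt.
Tailᶠ : ∀ {n} → Formula n
Tailᶠ = N ff

-- Formulas in neXt normal form: Boolean combinations of tt, ff, literals,
-- Tail, ¬Tail and next-formulas X χ (all temporal subformulas under X).
data XNF (n : ℕ) : Set where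
  tt ff : XNF n
  atom natom : Fin n → XNF n
  tail ntail : XNF n
  _∧ˣ_ _∨ˣ_ : XNF n → XNF n → XNF n
  next : Formula n → XNF n

toFormula : ∀ {n} → XNF n → Formula n
toFormula tt = tt
toFormula ff = ff
toFormula (atom p) = atom p
toFormula (natom p) = natom p
toFormula tail = N ff
toFormula ntail = X tt
toFormula (a ∧ˣ b) = toFormula a ∧ᶠ toFormula b
toFormula (a ∨ˣ b) = toFormula a ∨ᶠ toFormula b
toFormula (next χ) = X χ

xnf : ∀ {n} → Formula n → XNF n
xnf tt = tt
xnf ff = ff
xnf (atom p) = atom p
xnf (natom p) = natom p
xnf (a ∧ᶠ b) = xnf a ∧ˣ xnf b
xnf (a ∨ᶠ b) = xnf a ∨ˣ xnf b
xnf (X χ) = next χ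
xnf (N χ) = tail ∨ˣ next χ
xnf (a U b) = (tail ∧ˣ xnf b) ∨ˣ (ntail ∧ˣ (xnf b ∨ˣ (xnf a ∧ˣ next (a U b))))
xnf (a R b) = (tail ∧ˣ xnf b) ∨ˣ (xnf b ∧ˣ (xnf a ∨ˣ next (a R b)))

-- States: finite sets of formulas, represented by lists (read as conjunction).
State : ℕ → Set
State n = List (Formula n)

xnfSet : ∀ {n} → State n → XNF n
xnfSet = foldr (λ ψ acc → xnf ψ ∧ˣ acc) tt

-- Propositional abstraction: Boolean variables are the atoms, Tail, and
-- one fresh variable for each next-formula X χ.
data Var (n : ℕ) : Set where
  atomV : Fin n → Var n
  tailV : Var n
  nextV : Formula n → Var n

Assignment : ℕ → Set
Assignment n = Var n → Bool

⟦_⟧ᵖ : ∀ {n} → XNF n → Assignment n → Bool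
⟦ tt ⟧ᵖ A = true
⟦ ff ⟧ᵖ A = false
⟦ atom p ⟧ᵖ A = A (atomV p)
⟦ natom p ⟧ᵖ A = not (A (atomV p))
⟦ tail ⟧ᵖ A = A tailV
⟦ ntail ⟧ᵖ A = not (A tailV)
⟦ a ∧ˣ b ⟧ᵖ A = ⟦ a ⟧ᵖ A ∧ ⟦ b ⟧ᵖ A
⟦ a ∨ˣ b ⟧ᵖ A = ⟦ a ⟧ᵖ A ∨ ⟦ b ⟧ᵖ A
⟦ next χ ⟧ᵖ A = A (nextV χ)

nexts : ∀ {n} → XNF n → List (Formula n)
nexts (a ∧ˣ b) = nexts a ++ nexts b
nexts (a ∨ˣ b) = nexts a ++ nexts b
nexts (next χ) = χ ∷ []
nexts _ = []

Step : ∀ {n} → State n → State n → Set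
Step {n} s s' =
  Σ (Assignment n) λ A →
    (⟦ xnfSet s ⟧ᵖ A ≡ true) ×
    (∀ χ → (χ ∈ s') ⇔ ((χ ∈ nexts (xnfSet s)) × (A (nextV χ) ≡ true)))

Final : ∀ {n} → State n → Set
Final {n} s = Σ (Assignment n) λ A → (A tailV ≡ true) × (⟦ xnfSet s ⟧ᵖ A ≡ true)

data ReachesFinalIn {n : ℕ} : ℕ → State n → Set where
  here  : ∀ {s} → Final s → ReachesFinalIn zero s
  there : ∀ {k s t} → Step s t → ReachesFinalIn k t → ReachesFinalIn (suc k) s

record IsConflictSequence {n : ℕ} (φ : Formula n) (L : ℕ)
                          (C : ℕ → State n → Set) : Set where
  field
    nonempty : 0 < L
    initial  : ∀ i → i < L → C i (φ ∷ [])
    notFinal : ∀ s → C 0 s → Final s → ⊥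
    closed   : ∀ i → suc i < L → ∀ s → C (suc i) s → ∀ s' → Step s s' → C i s'

module Submission where

-- The defining property of a conflict sequence is a backward
-- invariant: C[0] contains no final state, and every one-transition next
-- state of a state in C[i+1] lies in C[i].  Hence, by induction on k, no
-- state of C[k] reaches a final state in exactly k steps (a path of length
-- k + 1 from s ∈ C[k+1] passes to a state of C[k] after its first step).

open import Defs
open import Data.Nat using (ℕ; zero; suc; _<_; _≤_)
open import Data.Nat.Properties using (≤-<-trans; n<1+n; <-trans)
open import Relation.Nullary using (¬_)

noFinalWithinLevel :
  ∀ {n} {L : ℕ} (C : ℕ → State n → Set) →
  (∀ s → C 0 s → ¬ Final s) →
  (∀ i → suc i < L → ∀ s → C (suc i) s → ∀ s' → Step s s' → C i s') →
  ∀ k s → k < L → C k s → ¬ ReachesFinalIn k s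
noFinalWithinLevel C noFinal closed zero s _ s∈C₀ (here final) =
  noFinal s s∈C₀ final
noFinalWithinLevel C noFinal closed (suc k) s k+1<L s∈Cₖ₊₁ (there {t = t} step reach) =
  noFinalWithinLevel C noFinal closed k t (<-trans (n<1+n k) k+1<L)
    (closed k k+1<L s s∈Cₖ₊₁ t step) reach

mainTheorem1 : (n : ℕ) (φ : Formula n) (L : ℕ) (C : ℕ → State n → Set) →
    IsConflictSequence φ L C →
    ∀ i → i < L → ∀ (s : State n) → (∀ j → j ≤ i → C j s) →
    ∀ k → k ≤ i → ¬ ReachesFinalIn k s
mainTheorem1 n φ L C conflict i i<L s s∈C≤i k k≤i =
  noFinalWithinLevel C notFinal closed k s (≤-<-trans k≤i i<L) (s∈C≤i k k≤i)
  where open IsConflictSequence conflict
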